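{- Let $A$ be the $3\times 18$ matrix with columns $a_1,\dots,a_6,d_1,\dots,d_{12}$ as in the context, $K=\{w\in\mathbb{Z}_+^{18}: Aw=0\}$, and $H$ the unique minimal Hilbert basis of $K$. If $u\in\mathbb{Z}_+^{18}$ satisfies $\max\{u_1,u_2,\dots,u_6\}\ge 2$, then $u\notin H$.
   Context: Columns of $A$: $a_1=(2,0,0)^T$, $a_2=(0,2,0)^T$, $a_3=(0,0,2)^T$, $a_4=(-2,0,0)^T$, $a_5=(0,-2,0)^T$, $a_6=(0,0,-2)^T$, $d_1=(1,1,0)^T$, $d_2=(1,-1,0)^T$, $d_3=(-1,1,0)^T$, $d_4=(-1,-1,0)^T$, $d_5=(1,0,1)^T$, $d_6=(1,0,-1)^T$, $d_7=(-1,0,1)^T$, $d_8=(-1,0,-1)^T$, $d_9=(0,1,1)^T$, $d_{10}=(0,1,-1)^T$, $d_{11}=(0,-1,1)^T$, $d_{12}=(0,-1,-1)^T$. Coordinates $u_1,\dots,u_6$ correspond to $a_1,\dots,a_6$ and $u_7,\dots,u_{18}$ to $d_1,\dots,d_{12}$. A Hilbert basis of $K$ is a finite subset $B\subseteq K$ such that every element of $K$ is a non-negative integer combination of elements of $B$; $H$ is the unique inclusion-minimal one (the nonzero elements of $K$ that are not sums of two nonzero elements of $K$). -}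

module Defs where

open import Data.Nat using (ℕ)
open import Data.Integer using (ℤ; +_; -[1+_]; _*_; _+_; 0ℤ)
open import Data.Fin using (Fin)
open import Data.Vec using (Vec; []; _∷_; lookup)
open import Data.Vec.Functional using (Vector; foldr)
open import Data.Product using (_×_; ∃; ∃₂)
open import Relation.Binary.PropositionalEquality using (_≡_)
open import Relation.Nullary using (¬_)

private
  z p1 p2 m1 m2 : ℤ
  z = + 0
  p1 = + 1
  p2 = + 2
  m1 = -[1+ 0 ]
  m2 = -[1+ 1 ]

-- columns of A, in the order a₁..a₆, d₁..d₁₂
columns : Vec (Vec ℤ 3) 18
columns =
  (p2 ∷ z ∷ z ∷ []) ∷ (z ∷ p2 ∷ z ∷ []) ∷ (z ∷ z ∷ p2 ∷ []) ∷
  (m2 ∷ z ∷ z ∷ []) ∷ (z ∷ m2 ∷ z ∷ []) ∷ (z ∷ z ∷ m2 ∷ []) ∷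
  (p1 ∷ p1 ∷ z ∷ []) ∷ (p1 ∷ m1 ∷ z ∷ []) ∷ (m1 ∷ p1 ∷ z ∷ []) ∷ (m1 ∷ m1 ∷ z ∷ []) ∷
  (p1 ∷ z ∷ p1 ∷ []) ∷ (p1 ∷ z ∷ m1 ∷ []) ∷ (m1 ∷ z ∷ p1 ∷ []) ∷ (m1 ∷ z ∷ m1 ∷ []) ∷
  (z ∷ p1 ∷ p1 ∷ []) ∷ (z ∷ p1 ∷ m1 ∷ []) ∷ (z ∷ m1 ∷ p1 ∷ []) ∷ (z ∷ m1 ∷ m1 ∷ []) ∷ []

A : Fin 3 → Fin 18 → ℤ
A i j = lookup (lookup columns j) i

Aw : (Fin 18 → ℕ) → Fin 3 → ℤ
Aw w i = foldr _+_ 0ℤ (λ j → A i j * + (w j))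

InK : (Fin 18 → ℕ) → Set
InK w = (i : Fin 3) → Aw w i ≡ 0ℤ

IsZero : (Fin 18 → ℕ) → Set
IsZero w = (j : Fin 18) → w j ≡ 0

-- H: the nonzero elements of K that are not sums of two nonzero elements of K
InH : (Fin 18 → ℕ) → Set
InH u = InK u × ¬ IsZero u ×
  ¬ (∃₂ λ (v w : Fin 18 → ℕ) →
        InK v × InK w × ¬ IsZero v × ¬ IsZero w ×
        ((j : Fin 18) → u j ≡ v j Data.Nat.+ w j))

{-# OPTIONS --safe #-}
-- Let a_k be a column with u_k ≥ 2 and split u = e_k + P + r, starting from P = 0.
-- While A (e_k + P) ≠ 0, some row i has s = (A (e_k + P))_i ≠ 0; as A r = − A (e_k + P),
-- r contains a column whose i-th entry has sign opposite to s, and one copy of it is moved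
-- from r to P. For each k an explicit list of values of A P, each with a chosen row, is
-- closed under these moves until A P = 0 or A P = − a_k, and the moves never take a_k itself.
-- Since r shrinks, the walk ends, and then u = P + (e_k + r) or u = (e_k + P) + r is a sum of
-- two nonzero elements of K: r keeps u_k − 1 ≥ 1 copies of a_k.
module Submission where

open import Defs
open import Data.Nat using (ℕ; _≥_)
open import Data.Fin using (Fin; _↑ˡ_)
open import Data.Product using (∃)
open import Relation.Nullary using (¬_)

import Algebra.Properties.Semiring.Sum as SemiringSum
open import Data.Fin using (zero; suc)
open import Data.Fin.Patterns using (0F; 1F; 2F; 3F; 4F; 5F)
open import Data.Fin.Properties using (all?; ¬∀⟶∃¬)
open import Data.Integer using (ℤ; +_; +[1+_]; -[1+_]; 0ℤ; 1ℤ; -1ℤ; -_; +<+)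
  renaming (_+_ to _+ℤ_; _*_ to _*ℤ_; _<_ to _<ℤ_; _≤_ to _≤ℤ_)
import Data.Integer.Properties as ℤ
open import Algebra.Properties.AbelianGroup ℤ.+-0-abelianGroup using (inverseʳ-unique)
open import Data.List using (List; []; _∷_)
open import Data.List.Relation.Unary.All as All using (All)
open import Data.List.Relation.Unary.Any as Any using (Any)
open import Data.Nat using (zero; suc; _+_; _∸_; _≤_; _<_; z≤n; s≤s; s≤s⁻¹; z<s)
import Data.Nat.Properties as ℕ
open import Algebra.Properties.CommutativeSemigroup ℕ.+-commutativeSemigroup using (xy∙z≈y∙xz)
open import Data.Nat.Tactic.RingSolver using (solve-∀)
open import Data.Product using (Σ; _×_; _,_; proj₁; ∃₂)
open import Data.Sum as Sum using (_⊎_; inj₁; inj₂)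
open import Data.Vec using (Vec; lookup; []; _∷_)
open import Function using (_∘_)
open import Relation.Binary.PropositionalEquality
open import Relation.Nullary using (Dec; ¬?; contradiction)
open import Relation.Nullary.Decidable using (from-yes; _×-dec_; _⊎-dec_; _→-dec_)

module ℤ∑ = SemiringSum ℤ.+-*-semiring
module ℕ∑ = SemiringSum ℕ.+-*-semiring

unit : ∀ {n} → Fin n → Fin n → ℕ
unit zero    zero     = 1
unit zero    (suc _)  = 0
unit (suc _) zero     = 0
unit (suc j) (suc j′) = unit j j′

unit-self : ∀ {n} (j : Fin n) → unit j j ≡ 1
unit-self zero    = refl
unit-self (suc j) = unit-self j

unit-other : ∀ {n} {j j′ : Fin n} → j ≢ j′ → unit j j′ ≡ 0
unit-other {j = zero}  {zero}   j≢j′ = contradiction refl j≢j′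
unit-other {j = zero}  {suc _}  _    = refl
unit-other {j = suc _} {zero}   _    = refl
unit-other {j = suc j} {suc j′} j≢j′ = unit-other (j≢j′ ∘ cong suc)

unit-≤ : ∀ {n} (r : Fin n → ℕ) {j} → 1 ≤ r j → ∀ j′ → unit j j′ ≤ r j′
unit-≤ r {zero}  1≤rj zero     = 1≤rj
unit-≤ r {zero}  _    (suc _)  = z≤n
unit-≤ r {suc _} _    zero     = z≤n
unit-≤ r {suc j} 1≤rj (suc j′) = unit-≤ (r ∘ suc) 1≤rj j′

sum-unit : ∀ {n} (j : Fin n) → ℕ∑.sum (unit j) ≡ 1
sum-unit {suc n} zero = cong suc (ℕ∑.sum-replicate-zero n)
sum-unit (suc j)      = sum-unit j

sum-*-unit : ∀ {n} (a : Fin n → ℤ) (j : Fin n) → ℤ∑.sum (λ j′ → a j′ *ℤ + unit j j′) ≡ a j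
sum-*-unit {suc n} a zero = begin
  a zero *ℤ + 1 +ℤ ℤ∑.sum (λ j′ → a (suc j′) *ℤ + 0)
    ≡⟨ cong₂ _+ℤ_ (ℤ.*-identityʳ (a zero)) rest≡0 ⟩
  a zero +ℤ 0ℤ
    ≡⟨ ℤ.+-identityʳ (a zero) ⟩
  a zero
    ∎
  where
  open ≡-Reasoning
  rest≡0 : ℤ∑.sum (λ j′ → a (suc j′) *ℤ + 0) ≡ 0ℤ
  rest≡0 = trans (ℤ∑.sum-cong-≗ (ℤ.*-zeroʳ ∘ a ∘ suc)) (ℤ∑.sum-replicate-zero n)
sum-*-unit a (suc j) = begin
  a zero *ℤ + 0 +ℤ ℤ∑.sum (λ j′ → a (suc j′) *ℤ + unit j j′)
    ≡⟨ cong₂ _+ℤ_ (ℤ.*-zeroʳ (a zero)) (sum-*-unit (a ∘ suc) j) ⟩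
  0ℤ +ℤ a (suc j)
    ≡⟨ ℤ.+-identityˡ (a (suc j)) ⟩
  a (suc j)
    ∎
  where open ≡-Reasoning

sum-nonNeg : ∀ {n} (f : Fin n → ℤ) → (∀ j → 0ℤ ≤ℤ f j) → 0ℤ ≤ℤ ℤ∑.sum f
sum-nonNeg {zero}  f _   = ℤ.≤-refl
sum-nonNeg {suc n} f f≥0 = ℤ.+-mono-≤ (f≥0 zero) (sum-nonNeg (f ∘ suc) (f≥0 ∘ suc))

sum-neg⇒∃-neg : ∀ {n} (f : Fin n → ℤ) → ℤ∑.sum f <ℤ 0ℤ → ∃ λ j → f j <ℤ 0ℤ
sum-neg⇒∃-neg {n} f ∑f<0
  with ¬∀⟶∃¬ n _ (λ j → 0ℤ ℤ.≤? f j) (ℤ.<⇒≱ ∑f<0 ∘ sum-nonNeg f)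
... | j , fj≱0 = j , ℤ.≰⇒> fj≱0

x*+m<0⇒1≤m×x<0 : ∀ x m → x *ℤ + m <ℤ 0ℤ → 1 ≤ m × x <ℤ 0ℤ
x*+m<0⇒1≤m×x<0 x zero    x*0<0 = contradiction (subst (_<ℤ 0ℤ) (ℤ.*-zeroʳ x) x*0<0) (ℤ.<-irrefl refl)
x*+m<0⇒1≤m×x<0 x (suc m) x*m<0 = s≤s z≤n , ℤ.*-cancelʳ-<-nonNeg (+ suc m) x*m<0

i≢0⇒i*i>0 : ∀ i → i ≢ 0ℤ → 0ℤ <ℤ i *ℤ i
i≢0⇒i*i>0 (+ zero)   i≢0 = contradiction refl i≢0
i≢0⇒i*i>0 +[1+ _ ]   _   = +<+ z<s
i≢0⇒i*i>0 -[1+ _ ]   _   = +<+ z<s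

opposing-term : ∀ {n} (a : Fin n → ℤ) (r : Fin n → ℕ) s → s ≢ 0ℤ →
  ℤ∑.sum (λ j → a j *ℤ + r j) ≡ - s → ∃ λ j → 1 ≤ r j × s *ℤ a j <ℤ 0ℤ
opposing-term a r s s≢0 ∑≡-s with sum-neg⇒∃-neg (λ j → s *ℤ (a j *ℤ + r j)) s∑<0
  where
  open ℤ.≤-Reasoning
  s∑<0 : ℤ∑.sum (λ j → s *ℤ (a j *ℤ + r j)) <ℤ 0ℤ
  s∑<0 = begin-strict
    ℤ∑.sum (λ j → s *ℤ (a j *ℤ + r j)) ≡⟨ ℤ∑.*-distribˡ-sum s (λ j → a j *ℤ + r j) ⟨
    s *ℤ ℤ∑.sum (λ j → a j *ℤ + r j)   ≡⟨ cong (s *ℤ_) ∑≡-s ⟩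
    s *ℤ - s                           ≡⟨ ℤ.neg-distribʳ-* s s ⟨
    - (s *ℤ s)                         <⟨ ℤ.neg-mono-< (i≢0⇒i*i>0 s s≢0) ⟩
    0ℤ                                 ∎
... | j , sajrj<0 =
  j , x*+m<0⇒1≤m×x<0 (s *ℤ a j) (r j) (subst (_<ℤ 0ℤ) (sym (ℤ.*-assoc s (a j) (+ r j))) sajrj<0)

Null : ∀ {n} → (Fin n → ℕ) → Set
Null w = ∀ j → w j ≡ 0

nonNull-at : ∀ {n} {w : Fin n → ℕ} j → 1 ≤ w j → ¬ Null w
nonNull-at j 1≤wj null = ℕ.n>0⇒n≢0 1≤wj (null j)

unit+-nonNull : ∀ {n} (j : Fin n) (w : Fin n → ℕ) → ¬ Null (λ j′ → unit j j′ + w j′)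
unit+-nonNull j w = nonNull-at j (subst (λ x → 1 ≤ x + w j) (sym (unit-self j)) (s≤s z≤n))

[a+b]+[c+d]≡[a+[d+b]]+c : ∀ a b c d → (a + b) + (c + d) ≡ (a + (d + b)) + c
[a+b]+[c+d]≡[a+[d+b]]+c = solve-∀

module Kernel {m n : ℕ} (M : Fin m → Fin n → ℤ) where

  image : (Fin n → ℕ) → Fin m → ℤ
  image w i = ℤ∑.sum (λ j → M i j *ℤ + w j)

  _+col_ : (Fin m → ℤ) → Fin n → Fin m → ℤ
  (σ +col j) i = σ i +ℤ M i j

  InKernel : (Fin n → ℕ) → Set
  InKernel w = ∀ i → image w i ≡ 0ℤ

  Decomposable : (Fin n → ℕ) → Set
  Decomposable u = ∃₂ λ v w → InKernel v × InKernel w × ¬ Null v × ¬ Null w ×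
    (∀ j → u j ≡ v j + w j)

  image-split : ∀ {u} v w → (∀ j → u j ≡ v j + w j) → ∀ i → image u i ≡ image v i +ℤ image w i
  image-split {u} v w u≡v+w i = begin
    ℤ∑.sum (λ j → M i j *ℤ + u j)
      ≡⟨ ℤ∑.sum-cong-≗ distrib ⟩
    ℤ∑.sum (λ j → M i j *ℤ + v j +ℤ M i j *ℤ + w j)
      ≡⟨ ℤ∑.∑-distrib-+ (λ j → M i j *ℤ + v j) (λ j → M i j *ℤ + w j) ⟩
    image v i +ℤ image w i
      ∎
    where
    open ≡-Reasoning
    distrib : ∀ j → M i j *ℤ + u j ≡ M i j *ℤ + v j +ℤ M i j *ℤ + w j
    distrib j = begin
      M i j *ℤ + u j                  ≡⟨ cong (λ x → M i j *ℤ + x) (u≡v+w j) ⟩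
      M i j *ℤ (+ v j +ℤ + w j)       ≡⟨ ℤ.*-distribˡ-+ (M i j) (+ v j) (+ w j) ⟩
      M i j *ℤ + v j +ℤ M i j *ℤ + w j ∎

  image-add-unit : ∀ v j → image (λ j′ → unit j j′ + v j′) ≗ image v +col j
  image-add-unit v j i = begin
    image (λ j′ → unit j j′ + v j′) i ≡⟨ image-split (unit j) v (λ _ → refl) i ⟩
    image (unit j) i +ℤ image v i     ≡⟨ cong (_+ℤ image v i) (sum-*-unit (M i) j) ⟩
    M i j +ℤ image v i                ≡⟨ ℤ.+-comm (M i j) (image v i) ⟩
    image v i +ℤ M i j                ∎
    where open ≡-Reasoning

  image-complement : ∀ {u} v w → (∀ j → u j ≡ v j + w j) → InKernel u →
    ∀ i → image w i ≡ - image v i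
  image-complement v w u≡v+w u∈K i =
    inverseʳ-unique (image v i) (image w i) (trans (sym (image-split v w u≡v+w i)) (u∈K i))

  kernel-complement : ∀ {u} v w → (∀ j → u j ≡ v j + w j) → InKernel u → InKernel v → InKernel w
  kernel-complement v w u≡v+w u∈K v∈K i = trans (image-complement v w u≡v+w u∈K i) (cong -_ (v∈K i))

module Walk {m n : ℕ} (M : Fin m → Fin n → ℤ) (k : Fin n) where
  open Kernel M

  Terminal : (Fin m → ℤ) → Set
  Terminal σ = (∀ i → σ i ≡ 0ℤ) ⊎ (∀ i → σ i ≡ - M i k)

  -- An entry (σ , i) is a value σ of M P and the row i along which the next column is chosen.
  Certificate : Set
  Certificate = List (Vec ℤ m × Fin m)

  Listed : Certificate → (Fin m → ℤ) → Set
  Listed S σ = Any (λ entry → lookup (proj₁ entry) ≗ σ) S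

  Covered : Certificate → (Fin m → ℤ) → Set
  Covered S σ = Terminal σ ⊎ Listed S σ

  Closed : Certificate → Vec ℤ m × Fin m → Set
  Closed S (σ , i) = s ≢ 0ℤ × (∀ j → s *ℤ M i j <ℤ 0ℤ → j ≢ k × Covered S (lookup σ +col j))
    where s = (lookup σ +col k) i

  Valid : Certificate → Set
  Valid S = Listed S (λ _ → 0ℤ) × All (Closed S) S

  terminal? : ∀ σ → Dec (Terminal σ)
  terminal? σ = all? (λ i → σ i ℤ.≟ 0ℤ) ⊎-dec all? (λ i → σ i ℤ.≟ - M i k)

  listed? : ∀ S σ → Dec (Listed S σ)
  listed? S σ = Any.any? (λ entry → all? λ i → lookup (proj₁ entry) i ℤ.≟ σ i) S

  covered? : ∀ S σ → Dec (Covered S σ)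
  covered? S σ = terminal? σ ⊎-dec listed? S σ

  closed? : ∀ S entry → Dec (Closed S entry)
  closed? S (σ , i) = ¬? (s ℤ.≟ 0ℤ) ×-dec all? λ j →
    s *ℤ M i j ℤ.<? 0ℤ →-dec (¬? (j Data.Fin.≟ k) ×-dec covered? S (lookup σ +col j))
    where s = (lookup σ +col k) i

  valid? : ∀ S → Dec (Valid S)
  valid? S = listed? S (λ _ → 0ℤ) ×-dec All.all? (closed? S) S

  terminal-resp : ∀ {σ τ} → σ ≗ τ → Terminal σ → Terminal τ
  terminal-resp σ≗τ (inj₁ σ≗0)   = inj₁ λ i → trans (sym (σ≗τ i)) (σ≗0 i)
  terminal-resp σ≗τ (inj₂ σ≗-ck) = inj₂ λ i → trans (sym (σ≗τ i)) (σ≗-ck i)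

  listed-resp : ∀ {S σ τ} → σ ≗ τ → Listed S σ → Listed S τ
  listed-resp σ≗τ = Any.map λ eq i → trans (eq i) (σ≗τ i)

  covered-resp : ∀ {S σ τ} → σ ≗ τ → Covered S σ → Covered S τ
  covered-resp σ≗τ = Sum.map (terminal-resp σ≗τ) (listed-resp σ≗τ)

  record State (u : Fin n → ℕ) : Set where
    field
      P r   : Fin n → ℕ
      split : ∀ j → u j ≡ (unit k j + P j) + r j
      1≤rₖ  : 1 ≤ r k

  open State

  initial : ∀ {u} → 2 ≤ u k → State u
  initial {u} 2≤uk = record
    { P     = λ _ → 0
    ; r     = λ j → u j ∸ unit k j
    ; split = λ j → trans (sym (ℕ.m+[n∸m]≡n (unit-≤ u (ℕ.≤-trans (s≤s z≤n) 2≤uk) j)))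
                          (cong (_+ (u j ∸ unit k j)) (sym (ℕ.+-identityʳ (unit k j))))
    ; 1≤rₖ  = subst (λ x → 1 ≤ u k ∸ x) (sym (unit-self k)) (ℕ.∸-monoˡ-≤ 1 2≤uk)
    }

  image-initial : ∀ {u} (2≤uk : 2 ≤ u k) → image (P (initial {u} 2≤uk)) ≗ λ _ → 0ℤ
  image-initial _ i = trans (ℤ∑.sum-cong-≗ (ℤ.*-zeroʳ ∘ M i)) (ℤ∑.sum-replicate-zero n)

  transfer : ∀ {u} (s : State u) j → 1 ≤ r s j → j ≢ k → State u
  transfer s j 1≤rj j≢k = record
    { P     = λ j′ → unit j j′ + P s j′
    ; r     = λ j′ → r s j′ ∸ unit j j′
    ; split = λ j′ → trans (split s j′) (move j′)
    ; 1≤rₖ  = subst (λ x → 1 ≤ r s k ∸ x) (sym (unit-other j≢k)) (1≤rₖ s)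
    }
    where
    move : ∀ j′ → (unit k j′ + P s j′) + r s j′
                ≡ (unit k j′ + (unit j j′ + P s j′)) + (r s j′ ∸ unit j j′)
    move j′ = trans (cong (_+_ (unit k j′ + P s j′)) (sym (ℕ.m∸n+n≡m (unit-≤ (r s) 1≤rj j′))))
                    ([a+b]+[c+d]≡[a+[d+b]]+c (unit k j′) (P s j′) (r s j′ ∸ unit j j′) (unit j j′))

  sum-transfer : ∀ {u} (s : State u) j (1≤rj : 1 ≤ r s j) (j≢k : j ≢ k) →
    ℕ∑.sum (r s) ≡ suc (ℕ∑.sum (r (transfer s j 1≤rj j≢k)))
  sum-transfer s j 1≤rj j≢k = begin
    ℕ∑.sum (r s)                         ≡⟨ ℕ∑.sum-cong-≗ (ℕ.m∸n+n≡m ∘ unit-≤ (r s) 1≤rj) ⟨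
    ℕ∑.sum (λ j′ → r s′ j′ + unit j j′)  ≡⟨ ℕ∑.∑-distrib-+ (r s′) (unit j) ⟩
    ℕ∑.sum (r s′) + ℕ∑.sum (unit j)      ≡⟨ cong (_+_ (ℕ∑.sum (r s′))) (sum-unit j) ⟩
    ℕ∑.sum (r s′) + 1                    ≡⟨ ℕ.+-comm (ℕ∑.sum (r s′)) 1 ⟩
    suc (ℕ∑.sum (r s′))                  ∎
    where
    open ≡-Reasoning
    s′ = transfer s j 1≤rj j≢k

  remainder-image : ∀ {u} → InKernel u → (s : State u) → ∀ i → image (r s) i ≡ - (image (P s) +col k) i
  remainder-image u∈K s i =
    trans (image-complement (λ j → unit k j + P s j) (r s) (split s) u∈K i)
          (cong -_ (image-add-unit (P s) k i))

  terminal⇒decomposable : ∀ {u} → InKernel u → (s : State u) → ¬ Null (P s) →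
    Terminal (image (P s)) → Decomposable u
  terminal⇒decomposable {u} u∈K s P≢0 (inj₁ P∈K) =
    P s , (λ j → unit k j + r s j) , P∈K , kernel-complement (P s) _ regroup u∈K P∈K ,
    P≢0 , unit+-nonNull k (r s) , regroup
    where
    regroup : ∀ j → u j ≡ P s j + (unit k j + r s j)
    regroup j = trans (split s j) (xy∙z≈y∙xz (unit k j) (P s j) (r s j))
  terminal⇒decomposable u∈K s _ (inj₂ P≗-aₖ) =
    (λ j → unit k j + P s j) , r s , eₖ+P∈K , kernel-complement _ (r s) (split s) u∈K eₖ+P∈K ,
    unit+-nonNull k (P s) , nonNull-at k (1≤rₖ s) , split s
    where
    eₖ+P∈K : InKernel (λ j → unit k j + P s j)
    eₖ+P∈K i = trans (image-add-unit (P s) k i)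
                     (trans (cong (_+ℤ M i k) (P≗-aₖ i)) (ℤ.+-inverseˡ (M i k)))

  module _ (S : Certificate) (S-closed : All (Closed S) S) where

    Advance : ∀ {u} → State u → Set
    Advance {u} s = Σ (State u) λ s′ →
      ℕ∑.sum (r s) ≡ suc (ℕ∑.sum (r s′)) × ¬ Null (P s′) × Covered S (image (P s′))

    advance-from : ∀ {u} → InKernel u → (s : State u) → ∀ entry → Closed S entry →
      lookup (proj₁ entry) ≗ image (P s) → Advance s
    advance-from u∈K s (σ , i) (s≢0 , closed) σ≗P
      with opposing-term (M i) (r s) ((lookup σ +col k) i) s≢0 r≡-s
      where
      r≡-s : image (r s) i ≡ - (lookup σ +col k) i
      r≡-s = trans (remainder-image u∈K s i) (cong (λ x → - (x +ℤ M i k)) (sym (σ≗P i)))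
    ... | j , 1≤rj , opposite with closed j opposite
    ... | j≢k , covered =
      transfer s j 1≤rj j≢k , sum-transfer s j 1≤rj j≢k , unit+-nonNull j (P s) ,
      covered-resp (λ i′ → trans (cong (_+ℤ M i′ j) (σ≗P i′)) (sym (image-add-unit (P s) j i′)))
                   covered

    advance : ∀ {u} → InKernel u → (s : State u) → Listed S (image (P s)) → Advance s
    advance u∈K s listed =
      let closed , σ≗P = All.lookupAny S-closed listed
      in advance-from u∈K s (Any.lookup listed) closed σ≗P

    walk : ∀ {u} → InKernel u → ∀ fuel (s : State u) → ℕ∑.sum (r s) < fuel →
      Listed S (image (P s)) → Σ (State u) λ s′ → ¬ Null (P s′) × Terminal (image (P s′))
    walk {u} u∈K (suc fuel) s ∑r<1+fuel listed = continue (advance u∈K s listed)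
      where
      continue : Advance s → Σ (State u) λ s′ → ¬ Null (P s′) × Terminal (image (P s′))
      continue (s′ , _ , P′≢0 , inj₁ terminal) = s′ , P′≢0 , terminal
      continue (s′ , ∑r≡1+∑r′ , _ , inj₂ listed′) =
        walk u∈K fuel s′ (subst (_≤ fuel) ∑r≡1+∑r′ (s≤s⁻¹ ∑r<1+fuel)) listed′

  valid⇒decomposable : ∀ S → Valid S → ∀ {u} → InKernel u → 2 ≤ u k → Decomposable u
  valid⇒decomposable S (0-listed , S-closed) {u} u∈K 2≤uk =
    let s , P≢0 , terminal = walk S S-closed u∈K _ s₀ (ℕ.n<1+n (ℕ∑.sum (r s₀)))
                                  (listed-resp (sym ∘ image-initial {u} 2≤uk) 0-listed)
    in terminal⇒decomposable u∈K s P≢0 terminal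
    where
    s₀ : State u
    s₀ = initial 2≤uk

-- For a_k = ±2 e_x the values of A P are 0 (with row x) and ∓e_x ± e_y (with row y) for both y ≠ x.
certificate : Fin 6 → List (Vec ℤ 3 × Fin 3)
certificate 0F =
  (0ℤ ∷ 0ℤ ∷ 0ℤ ∷ [] , 0F) ∷
  (-1ℤ ∷ 1ℤ ∷ 0ℤ ∷ [] , 1F) ∷ (-1ℤ ∷ -1ℤ ∷ 0ℤ ∷ [] , 1F) ∷
  (-1ℤ ∷ 0ℤ ∷ 1ℤ ∷ [] , 2F) ∷ (-1ℤ ∷ 0ℤ ∷ -1ℤ ∷ [] , 2F) ∷ []
certificate 1F =
  (0ℤ ∷ 0ℤ ∷ 0ℤ ∷ [] , 1F) ∷
  (1ℤ ∷ -1ℤ ∷ 0ℤ ∷ [] , 0F) ∷ (-1ℤ ∷ -1ℤ ∷ 0ℤ ∷ [] , 0F) ∷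
  (0ℤ ∷ -1ℤ ∷ 1ℤ ∷ [] , 2F) ∷ (0ℤ ∷ -1ℤ ∷ -1ℤ ∷ [] , 2F) ∷ []
certificate 2F =
  (0ℤ ∷ 0ℤ ∷ 0ℤ ∷ [] , 2F) ∷
  (1ℤ ∷ 0ℤ ∷ -1ℤ ∷ [] , 0F) ∷ (-1ℤ ∷ 0ℤ ∷ -1ℤ ∷ [] , 0F) ∷
  (0ℤ ∷ 1ℤ ∷ -1ℤ ∷ [] , 1F) ∷ (0ℤ ∷ -1ℤ ∷ -1ℤ ∷ [] , 1F) ∷ []
certificate 3F =
  (0ℤ ∷ 0ℤ ∷ 0ℤ ∷ [] , 0F) ∷
  (1ℤ ∷ 1ℤ ∷ 0ℤ ∷ [] , 1F) ∷ (1ℤ ∷ -1ℤ ∷ 0ℤ ∷ [] , 1F) ∷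
  (1ℤ ∷ 0ℤ ∷ 1ℤ ∷ [] , 2F) ∷ (1ℤ ∷ 0ℤ ∷ -1ℤ ∷ [] , 2F) ∷ []
certificate 4F =
  (0ℤ ∷ 0ℤ ∷ 0ℤ ∷ [] , 1F) ∷
  (1ℤ ∷ 1ℤ ∷ 0ℤ ∷ [] , 0F) ∷ (-1ℤ ∷ 1ℤ ∷ 0ℤ ∷ [] , 0F) ∷
  (0ℤ ∷ 1ℤ ∷ 1ℤ ∷ [] , 2F) ∷ (0ℤ ∷ 1ℤ ∷ -1ℤ ∷ [] , 2F) ∷ []
certificate 5F =
  (0ℤ ∷ 0ℤ ∷ 0ℤ ∷ [] , 2F) ∷
  (1ℤ ∷ 0ℤ ∷ 1ℤ ∷ [] , 0F) ∷ (-1ℤ ∷ 0ℤ ∷ 1ℤ ∷ [] , 0F) ∷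
  (0ℤ ∷ 1ℤ ∷ 1ℤ ∷ [] , 1F) ∷ (0ℤ ∷ -1ℤ ∷ 1ℤ ∷ [] , 1F) ∷ []

certificate-valid : ∀ k → Walk.Valid A (k ↑ˡ 12) (certificate k)
certificate-valid = from-yes (all? λ k → Walk.valid? A (k ↑ˡ 12) (certificate k))

theorem7 : (u : Fin 18 → ℕ) →
    (∃ λ (k : Fin 6) → u ((k ↑ˡ 12)) ≥ 2) → ¬ InH u
theorem7 u (k , 2≤uk) (u∈K , _ , indecomposable) =
  indecomposable (Walk.valid⇒decomposable A (k ↑ˡ 12) (certificate k) (certificate-valid k) u∈K 2≤uk)
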